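{- Let $t \geq 1$ and let $\Gamma$ be a $k$-regular graph of girth $2t+1$ that contains no cycle of length $2t+2$. Let $v$ be any vertex of $\Gamma$ and let $\mathcal{T}$ be a Moore tree $\mathcal{T}_v(k,2t+1)$ rooted at $v$ that is a subgraph of $\Gamma$, with set of leaves $S$. Then the set $E(S)$ of horizontal edges of $\mathcal{T}$ satisfies \[ |E(S)| \leq \frac{k(k-1)^{t-1}}{2}. \]
   Context: All graphs are finite, simple and undirected; the girth is the length of a shortest cycle. For a vertex $v$ of a $k$-regular graph $\Gamma$ of girth $2t+1$, the Moore tree $\mathcal{T}_v(k,2t+1)$ rooted at $v$ is the subgraph of $\Gamma$ which is a rooted tree with root $v$, in which $v$ has $k$ children, every non-root, non-leaf vertex has $k-1$ children (all its other neighbours in $\Gamma$), and every leaf is at distance exactly $t$ from $v$; equivalently it consists of the vertices at distance at most $t$ from $v$ together with the edges of the breadth-first tree from $v$. It has $k(k-1)^{t-1}$ leaves. A horizontal edge of $\mathcal{T}_v(k,2t+1)$ is an edge of $\Gamma$ joining two leaves of $\mathcal{T}_v(k,2t+1)$; $E(S)$ denotes the set of these edges. -}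

module Defs where

open import Data.Nat using (ℕ; zero; suc; _+_; _*_; _∸_; _^_; _≤_; _<_)
open import Data.Fin using (Fin; zero; suc; inject₁; fromℕ)
import Data.Fin as F
open import Data.Bool using (Bool; true; false; if_then_else_)
open import Data.List using (List; map; allFin; length)
open import Data.Nat.ListAction using (sum)
open import Data.List.Relation.Unary.All using (All)
open import Data.List.Relation.Unary.Unique.Propositional using (Unique)
open import Data.Product using (Σ; _×_; _,_)
open import Function.Definitions using (Injective)
open import Relation.Binary.PropositionalEquality using (_≡_)
open import Relation.Nullary using (¬_)

record Graph (n : ℕ) : Set where
  field
    adj    : Fin n → Fin n → Bool
    sym    : ∀ i j → adj i j ≡ adj j i
    irrefl : ∀ i → adj i i ≡ false

open Graph public

module _ {n : ℕ} (G : Graph n) where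

  Adj : Fin n → Fin n → Set
  Adj i j = adj G i j ≡ true

  degree : Fin n → ℕ
  degree i = sum (map (λ j → if adj G i j then 1 else 0) (allFin n))

  Regular : ℕ → Set
  Regular k = ∀ i → degree i ≡ k

  -- a cycle of length m+3: m+3 distinct vertices, consecutive ones adjacent,
  -- and the last adjacent to the first
  CycleOfLength : ℕ → Set
  CycleOfLength m = Σ (Fin (suc (suc (suc m))) → Fin n) λ f →
      Injective _≡_ _≡_ f
    × (∀ (i : Fin (suc (suc m))) → Adj (f (inject₁ i)) (f (suc i)))
    × Adj (f (fromℕ (suc (suc m)))) (f zero)

  HasCycle : ℕ → Set
  HasCycle ℓ = Σ ℕ λ m → (ℓ ≡ m + 3) × CycleOfLength m

  HasGirth : ℕ → Set
  HasGirth g = HasCycle g × (∀ ℓ → ℓ < g → ¬ HasCycle ℓ)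

  Walk : ℕ → Fin n → Fin n → Set
  Walk ℓ u w = Σ (Fin (suc ℓ) → Fin n) λ f →
      f zero ≡ u × f (fromℕ ℓ) ≡ w
    × (∀ (i : Fin ℓ) → Adj (f (inject₁ i)) (f (suc i)))

  Distance : Fin n → Fin n → ℕ → Set
  Distance u w d = Walk d u w × (∀ ℓ → ℓ < d → ¬ Walk ℓ u w)

  -- w is a leaf of the Moore tree T_v(k,2t+1): distance exactly t from v
  Leaf : Fin n → ℕ → Fin n → Set
  Leaf v t w = Distance v w t

  -- a horizontal edge {u,w} of T_v(k,2t+1), recorded as ordered pair with u < w
  Horizontal : Fin n → ℕ → Fin n × Fin n → Set
  Horizontal v t (u , w) = u F.< w × Adj u w × Leaf v t u × Leaf v t w

{-# OPTIONS --safe #-}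
-- Every endpoint of a horizontal edge is a leaf, i.e. lies at distance t from v, and no leaf u
-- has two distinct leaf neighbours w₁, w₂: climbing from w₁ and w₂ towards v until the two
-- branches meet gives a path w₁ ⋯ w₂ of even length 2h ≤ 2t whose inner vertices are closer to v
-- than u, and with u it closes into a cycle of length 2h + 2, which is shorter than the girth if
-- h < t and is the excluded length 2t + 2 if h = t.  So the horizontal edges form a matching on
-- the leaves, and 2|E(S)| is at most the number of leaves.  A vertex at distance d ≥ 1 has at
-- most k − 1 neighbours at distance d + 1, since its parent is another neighbour; hence there are
-- at most k(k − 1)^(d−1) vertices at distance d.

module Submission where

open import Defs
open import Data.Nat using (ℕ; zero; suc; _+_; _*_; _∸_; _^_; _≤_; _<_; s≤s; z≤n)
open import Data.Nat.Properties
  using (≤-refl; +-comm; +-suc; +-mono-≤; *-comm; *-assoc; *-suc; *-identityʳ; *-monoˡ-≤; *-monoʳ-≤;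
         ∸-monoˡ-≤; <-cmp; <⇒≢; >⇒≢; n<1+n; m<n⇒m<1+n; m<m+n; m≤n⇒m<n∨m≡n; module ≤-Reasoning)
open import Data.Nat.ListAction using (sum)
open import Data.Fin using (Fin; zero; suc; inject₁; fromℕ)
import Data.Fin.Properties as F
open import Data.Vec.Functional using (Vector)
import Data.Vec.Functional as V
open import Data.Bool using (true; if_then_else_)
import Data.Bool.Properties as Bool
open import Data.List using (List; []; _∷_; length; map; filter; allFin)
open import Data.List.Relation.Unary.All using (All; []; _∷_)
import Data.List.Relation.Unary.All as All
import Data.List.Relation.Unary.All.Properties as All
open import Data.List.Relation.Unary.Any using (Any; here; there)
import Data.List.Relation.Unary.Any as Any
open import Data.List.Relation.Unary.AllPairs using ([]; _∷_)
open import Data.List.Relation.Unary.Unique.Propositional using (Unique)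
import Data.List.Relation.Unary.Unique.Propositional.Properties as Unique
open import Data.List.Membership.Propositional.Properties using (∈-allFin)
open import Data.Product using (_×_; ∃-syntax; _,_; proj₁; proj₂)
open import Data.Sum using (_⊎_; inj₁; inj₂)
open import Function using (_∘_)
open import Function.Definitions using (Injective)
open import Level using (0ℓ)
open import Relation.Nullary using (¬_; yes; no; contradiction)
open import Relation.Unary using (Decidable)
open import Relation.Unary.Properties using (∁?)
open import Relation.Binary using (Rel; Asymmetric; Symmetric; DecidableEquality; tri<; tri≈; tri>)
open import Relation.Binary.PropositionalEquality using (_≡_; _≢_; ≢-sym; refl; trans; cong; subst; subst₂)
import Relation.Binary.PropositionalEquality as ≡

module _ {A : Set} where

  _∷ʳ_ : ∀ {m} → Vector A m → A → Vector A (suc m)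
  _∷ʳ_ {zero}  f x _       = x
  _∷ʳ_ {suc m} f x zero    = f zero
  _∷ʳ_ {suc m} f x (suc i) = ((f ∘ suc) ∷ʳ x) i

  ∷ʳ-last : ∀ {m} (f : Vector A m) x → (f ∷ʳ x) (fromℕ m) ≡ x
  ∷ʳ-last {zero}  f x = refl
  ∷ʳ-last {suc m} f x = ∷ʳ-last (f ∘ suc) x

  ∷ʳ-all : ∀ {m} (P : A → Set) {f : Vector A m} {x} → (∀ i → P (f i)) → P x →
           ∀ j → P ((f ∷ʳ x) j)
  ∷ʳ-all {zero}  P     pf px _       = px
  ∷ʳ-all {suc m} P     pf px zero    = pf zero
  ∷ʳ-all {suc m} P {f} pf px (suc j) = ∷ʳ-all P {f = f ∘ suc} (pf ∘ suc) px j

  private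
    head∉tail : ∀ {m} {f : Vector A (suc m)} {x} → Injective _≡_ _≡_ f → (∀ i → f i ≢ x) →
                ∀ j → f zero ≢ ((f ∘ suc) ∷ʳ x) j
    head∉tail {f = f} inj f≢x = ∷ʳ-all (f zero ≢_) (λ i e → F.0≢1+n (inj e)) (f≢x zero)

  ∷ʳ-injective : ∀ {m} {f : Vector A m} {x} → Injective _≡_ _≡_ f → (∀ i → f i ≢ x) →
                 Injective _≡_ _≡_ (f ∷ʳ x)
  ∷ʳ-injective {zero}  inj f≢x {zero}  {zero}  _  = refl
  ∷ʳ-injective {suc m} inj f≢x {zero}  {zero}  _  = refl
  ∷ʳ-injective {suc m} inj f≢x {zero}  {suc j} eq = contradiction eq (head∉tail inj f≢x j)
  ∷ʳ-injective {suc m} inj f≢x {suc i} {zero}  eq = contradiction (≡.sym eq) (head∉tail inj f≢x i)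
  ∷ʳ-injective {suc m} inj f≢x {suc i} {suc j} eq =
    cong suc (∷ʳ-injective (F.suc-injective ∘ inj) (f≢x ∘ suc) eq)

  ∷-all : ∀ {m} (P : A → Set) {x} {f : Vector A m} → P x → (∀ i → P (f i)) →
          ∀ j → P ((x V.∷ f) j)
  ∷-all P px pf zero    = px
  ∷-all P px pf (suc j) = pf j

  ∷-injective : ∀ {m} {x} {f : Vector A m} → (∀ i → x ≢ f i) → Injective _≡_ _≡_ f →
                Injective _≡_ _≡_ (x V.∷ f)
  ∷-injective x∉f inj {zero}  {zero}  _  = refl
  ∷-injective x∉f inj {zero}  {suc j} eq = contradiction eq (x∉f j)
  ∷-injective x∉f inj {suc i} {zero}  eq = contradiction (≡.sym eq) (x∉f i)
  ∷-injective x∉f inj {suc i} {suc j} eq = cong suc (inj eq)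

  Linked : ∀ {m} → Rel A 0ℓ → Vector A (suc m) → Set
  Linked R f = ∀ i → R (f (inject₁ i)) (f (suc i))

  ∷ʳ-linked : ∀ {m} {R : Rel A 0ℓ} {f : Vector A (suc m)} {x} → Linked R f → R (f (fromℕ m)) x →
              Linked R (f ∷ʳ x)
  ∷ʳ-linked {zero}          lf r zero    = r
  ∷ʳ-linked {suc m}         lf r zero    = lf zero
  ∷ʳ-linked {suc m} {R} {f} lf r (suc i) = ∷ʳ-linked {R = R} {f = f ∘ suc} (lf ∘ suc) r i

  ∷-linked : ∀ {m} {R : Rel A 0ℓ} {x} {f : Vector A (suc m)} → R x (f zero) → Linked R f →
             Linked R (x V.∷ f)
  ∷-linked r lf zero    = r
  ∷-linked r lf (suc i) = lf i

-- |{x ∣ P x}| ≤ c, phrased so that P need not be decidable.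
AtMost : {A : Set} → (A → Set) → ℕ → Set
AtMost {A} P c = ∀ {xs : List A} → Unique xs → All P xs → length xs ≤ c

sum-map-const : ∀ {A : Set} c (xs : List A) → sum (map (λ _ → c) xs) ≡ length xs * c
sum-map-const c []       = refl
sum-map-const c (x ∷ xs) = cong (c +_) (sum-map-const c xs)

module _ {A : Set} {P : A → Set} (P? : Decidable P) where

  length-filter+∁ : ∀ xs → length (filter P? xs) + length (filter (∁? P?) xs) ≡ length xs
  length-filter+∁ []       = refl
  length-filter+∁ (x ∷ xs) with P? x
  ... | yes _ = cong suc (length-filter+∁ xs)
  ... | no  _ = trans (+-suc _ _) (cong suc (length-filter+∁ xs))

module _ {A B : Set} {Q : A → Set} {R : B → A → Set} (R? : ∀ u → Decidable (R u)) where

  length≤sum-of-fibres : ∀ (c : B → ℕ) P {L} → Unique L → All Q L →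
                         All (λ x → Any (λ u → R u x) P) L →
                         All (λ u → AtMost (λ x → R u x × Q x) (c u)) P →
                         length L ≤ sum (map c P)
  length≤sum-of-fibres c []      {[]}    _  _  _          _          = z≤n
  length≤sum-of-fibres c []      {x ∷ L} _  _  (() ∷ _)   _
  length≤sum-of-fibres c (u ∷ P) {L}     uL qL covered (bound-u ∷ bound-P) = begin
    length L                                                 ≡⟨ length-filter+∁ (R? u) L ⟨
    length (filter (R? u) L) + length (filter (∁? (R? u)) L) ≤⟨ +-mono-≤ fibre-u rest ⟩
    c u + sum (map c P)                                      ∎
    where
    open ≤-Reasoning
    fibre-u : length (filter (R? u) L) ≤ c u
    fibre-u = bound-u (Unique.filter⁺ (R? u) uL)
                      (All.zip (All.all-filter (R? u) L , All.filter⁺ (R? u) qL))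
    rest : length (filter (∁? (R? u)) L) ≤ sum (map c P)
    rest = length≤sum-of-fibres c P (Unique.filter⁺ (∁? (R? u)) uL) (All.filter⁺ (∁? (R? u)) qL)
             (All.zipWith (λ (¬r , any) → Any.tail ¬r any)
                          (All.all-filter (∁? (R? u)) L , All.filter⁺ (∁? (R? u)) covered))
             bound-P

module _ {A B : Set} {Q : A → Set} {Par : B → Set} {R : B → A → Set} (_≟_ : DecidableEquality B)
         (parent : ∀ {x} → Q x → ∃[ u ] Par u × R u x) where

  open import Data.List.Membership.DecPropositional _≟_ using (_∈?_)

  parents : ∀ {L} → All Q L →
            ∃[ P ] Unique P × All Par P × All (λ x → Any (λ u → R u x) P) L
  parents []         = [] , [] , [] , []
  parents (qx ∷ qL) with parents qL | parent qx
  ... | P , uP , parP , covered | u , par-u , rux with u ∈? P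
  ... | yes u∈P = P , uP , parP , Any.map (λ { refl → rux }) u∈P ∷ covered
  ... | no  u∉P = u ∷ P , All.¬Any⇒All¬ P u∉P ∷ uP , par-u ∷ parP , here rux ∷ All.map there covered

  AtMost-by-parents : ∀ {N c} → (∀ u → Decidable (R u)) → AtMost Par N →
                      (∀ {u} → Par u → AtMost (λ x → R u x × Q x) c) → AtMost Q (N * c)
  AtMost-by-parents {N} {c} R? few-parents few-children {L} uL qL with parents qL
  ... | P , uP , parP , covered = begin
    length L              ≤⟨ length≤sum-of-fibres R? (λ _ → c) P uL qL covered (All.map few-children parP) ⟩
    sum (map (λ _ → c) P) ≡⟨ sum-map-const c P ⟩
    length P * c          ≤⟨ *-monoˡ-≤ c (few-parents uP parP) ⟩
    N * c                 ∎
    where open ≤-Reasoning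

endpoints : {A : Set} → List (A × A) → List A
endpoints []            = []
endpoints ((a , b) ∷ E) = a ∷ b ∷ endpoints E

length-endpoints : {A : Set} (E : List (A × A)) → length (endpoints E) ≡ 2 * length E
length-endpoints []      = refl
length-endpoints (_ ∷ E) = trans (cong (2 +_) (length-endpoints E)) (≡.sym (*-suc 2 (length E)))

All-endpoints : {A : Set} {P : A → Set} {E : List (A × A)} →
                All (λ e → P (proj₁ e) × P (proj₂ e)) E → All P (endpoints E)
All-endpoints []                = []
All-endpoints ((pa , pb) ∷ pE) = pa ∷ pb ∷ All-endpoints pE

module _ {A : Set} {_<_ R : Rel A 0ℓ} (<-asym : Asymmetric _<_) (R-sym : Symmetric R)
         (R-functional : ∀ {x y z} → R x y → R x z → y ≡ z) where

  OrientedEdge : A × A → Set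
  OrientedEdge (a , b) = a < b × R a b

  private
    disjoint : ∀ {a b c d} → OrientedEdge (a , b) → OrientedEdge (c , d) → (a , b) ≢ (c , d) →
               (a ≢ c × b ≢ c) × (a ≢ d × b ≢ d)
    disjoint {a} {b} {c} {d} (a<b , Rab) (c<d , Rcd) ab≢cd = (a≢c , b≢c) , (a≢d , b≢d)
      where
      a≢c : a ≢ c
      a≢c refl = ab≢cd (cong (a ,_) (R-functional Rab Rcd))
      b≢d : b ≢ d
      b≢d refl = ab≢cd (cong (_, b) (R-functional (R-sym Rab) (R-sym Rcd)))
      a≢d : a ≢ d
      a≢d refl = <-asym a<b (subst (_< a) (R-functional (R-sym Rcd) Rab) c<d)
      b≢c : b ≢ c
      b≢c refl = <-asym a<b (subst (b <_) (R-functional Rcd (R-sym Rab)) c<d)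

  endpoints-unique : ∀ {E} → Unique E → All OrientedEdge E → Unique (endpoints E)
  endpoints-unique {[]}          []          []           = []
  endpoints-unique {(a , b) ∷ E} (ab∉E ∷ uE) (ab ∷ edges) =
    (a≢b ∷ All.map proj₁ fresh) ∷ All.map proj₂ fresh ∷ endpoints-unique uE edges
    where
    a≢b : a ≢ b
    a≢b refl = <-asym (proj₁ ab) (proj₁ ab)
    fresh : All (λ x → a ≢ x × b ≢ x) (endpoints E)
    fresh = All-endpoints (All.zipWith (λ (ne , cd) → disjoint ab cd ne) (ab∉E , edges))

module _ {n : ℕ} (G : Graph n) where

  Adj-sym : ∀ {i j} → Adj G i j → Adj G j i
  Adj-sym {i} {j} a = trans (Graph.sym G j i) a

  Adj⇒≢ : ∀ {i j} → Adj G i j → i ≢ j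
  Adj⇒≢ {i} a refl with trans (≡.sym a) (Graph.irrefl G i)
  ... | ()

  Adj? : ∀ i → Decidable (Adj G i)
  Adj? i j = adj G i j Bool.≟ true

  -- Count the neighbours in the fibres {y}, y ∈ Fin n; the fibre of y holds at most [u ∼ y] of them.
  neighbours-atMost : ∀ {u} → AtMost (Adj G u) (degree G u)
  neighbours-atMost {u} uM adjM =
    length≤sum-of-fibres (λ y x → x F.≟ y) (λ y → if adj G u y then 1 else 0) (allFin n)
      uM adjM (All.tabulate (λ {x} _ → ∈-allFin x)) (All.tabulate (λ {y} _ → fibre y))
    where
    fibre : ∀ y → AtMost (λ x → x ≡ y × Adj G u x) (if adj G u y then 1 else 0)
    fibre y {[]}         _                _                             = z≤n
    fibre y {x ∷ []}     _                ((refl , a) ∷ [])             =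
      subst (λ b → 1 ≤ (if b then 1 else 0)) (≡.sym a) ≤-refl
    fibre y {x ∷ x' ∷ _} ((x≢x' ∷ _) ∷ _) ((refl , _) ∷ (refl , _) ∷ _) = contradiction refl x≢x'

  vertices : ∀ {ℓ u w} → Walk G ℓ u w → Fin (suc ℓ) → Fin n
  vertices = proj₁

  Walk-refl : ∀ {u} → Walk G 0 u u
  Walk-refl {u} = (λ _ → u) , refl , refl , λ ()

  Walk-∷ : ∀ {ℓ x u w} → Adj G x u → Walk G ℓ u w → Walk G (suc ℓ) x w
  Walk-∷ {x = x} xu (f , f0 , fℓ , steps) =
    x V.∷ f , refl , fℓ , ∷-linked {R = Adj G} (subst (Adj G x) (≡.sym f0) xu) steps

  Walk-∷ʳ : ∀ {ℓ u w x} → Walk G ℓ u w → Adj G w x → Walk G (suc ℓ) u x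
  Walk-∷ʳ {x = x} (f , f0 , fℓ , steps) wx =
    f ∷ʳ x , f0 , ∷ʳ-last f x , ∷ʳ-linked {R = Adj G} steps (subst (λ y → Adj G y x) (≡.sym fℓ) wx)

  Walk-unsnoc : ∀ {ℓ u x} → Walk G (suc ℓ) u x → ∃[ w ] Walk G ℓ u w × Adj G w x
  Walk-unsnoc {ℓ} (f , f0 , fℓ , steps) =
    f (inject₁ (fromℕ ℓ)) , (f ∘ inject₁ , f0 , refl , steps ∘ inject₁) ,
    subst (Adj G (f (inject₁ (fromℕ ℓ)))) fℓ (steps (fromℕ ℓ))

  Walk⇒HasCycle : ∀ {ℓ a b u} (w : Walk G (suc ℓ) a b) → Injective _≡_ _≡_ (vertices w) →
                  (∀ i → u ≢ vertices w i) → Adj G u a → Adj G b u → HasCycle G (suc ℓ + 2)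
  Walk⇒HasCycle {ℓ} {u = u} (f , f0 , fℓ , steps) inj u∉w ua bu =
    ℓ , ≡.sym (+-suc ℓ 2) , u V.∷ f , ∷-injective u∉w inj ,
    ∷-linked {R = Adj G} (subst (Adj G u) (≡.sym f0) ua) steps , subst (λ y → Adj G y u) (≡.sym fℓ) bu

  module _ {u : Fin n} where

    Distance-unique : ∀ {x i j} → Distance G u x i → Distance G u x j → i ≡ j
    Distance-unique {i = i} {j} (wi , min-i) (wj , min-j) with <-cmp i j
    ... | tri< i<j _ _ = contradiction wi (min-j i i<j)
    ... | tri≈ _ i≡j _ = i≡j
    ... | tri> _ _ j<i = contradiction wj (min-i j j<i)

    Distance-≢ : ∀ {x y i j} → Distance G u x i → Distance G u y j → i ≢ j → x ≢ y
    Distance-≢ dx dy i≢j refl = i≢j (Distance-unique dx dy)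

    Distance-zero : ∀ {x} → Distance G u x 0 → x ≡ u
    Distance-zero ((f , f0 , f0≡x , _) , _) = trans (≡.sym f0≡x) f0

    Distance-one : ∀ {x} → Distance G u x 1 → Adj G u x
    Distance-one ((f , f0 , f1 , steps) , _) = subst₂ (Adj G) f0 f1 (steps zero)

    Distance-parent : ∀ {x d} → Distance G u x (suc d) → ∃[ w ] Distance G u w d × Adj G w x
    Distance-parent (walk , minimal) with Walk-unsnoc walk
    ... | w , walk-w , wx =
      w , (walk-w , λ ℓ ℓ<d walk' → minimal (suc ℓ) (s≤s ℓ<d) (Walk-∷ʳ walk' wx)) , wx

  module _ (v : Fin n) where

    Below : ℕ → Fin n → Set
    Below s x = ∃[ d ] d < s × Distance G v x d

    Below⇒≢ : ∀ {s x y} → Distance G v x s → Below s y → x ≢ y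
    Below⇒≢ dx (d , d<s , dy) = Distance-≢ dx dy (>⇒≢ d<s)

    EndOrBelow : ℕ → Fin n → Fin n → Fin n → Set
    EndOrBelow s a b x = x ≡ a ⊎ x ≡ b ⊎ Below s x

    -- The path from a up the breadth-first tree to a common ancestor and back down to b.
    record Detour (s : ℕ) (a b : Fin n) : Set where
      field
        half      : ℕ
        half≤s    : half ≤ s
        len       : ℕ
        len≡      : len ≡ 2 * half
        walk      : Walk G len a b
        injective : Injective _≡_ _≡_ (vertices walk)
        inside    : ∀ i → EndOrBelow s a b (vertices walk i)

    detour-extend : ∀ {s a b a' b'} → a ≢ b → Distance G v a (suc s) → Distance G v b (suc s) →
                    Distance G v a' s → Distance G v b' s → Adj G a a' → Adj G b' b →
                    Detour s a' b' → Detour (suc s) a b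
    detour-extend {s} {a} {b} a≢b da db da' db' aa' b'b δ = record
      { half      = suc half
      ; half≤s    = s≤s half≤s
      ; len       = 2 + len
      ; len≡      = trans (cong (2 +_) len≡) (≡.sym (*-suc 2 half))
      ; walk      = Walk-∷ aa' (Walk-∷ʳ walk b'b)
      ; injective = ∷-injective (∷ʳ-all (a ≢_) (λ i → Below⇒≢ da (below i)) a≢b)
                                (∷ʳ-injective injective (λ i → ≢-sym (Below⇒≢ db (below i))))
      ; inside    = ∷-all (EndOrBelow (suc s) a b) (inj₁ refl)
                          (∷ʳ-all (EndOrBelow (suc s) a b) (λ i → inj₂ (inj₂ (below i)))
                                  (inj₂ (inj₁ refl)))
      }
      where
      open Detour δ
      below : ∀ i → Below (suc s) (vertices walk i)
      below i with inside i
      ... | inj₁ eq                    = s , n<1+n s , subst (λ x → Distance G v x s) (≡.sym eq) da'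
      ... | inj₂ (inj₁ eq)             = s , n<1+n s , subst (λ x → Distance G v x s) (≡.sym eq) db'
      ... | inj₂ (inj₂ (d , d<s , dd)) = d , m<n⇒m<1+n d<s , dd

    detour : ∀ s {a b} → Distance G v a s → Distance G v b s → Detour s a b
    detour s {a} {b} da db with a F.≟ b
    ... | yes refl = record
      { half = 0 ; half≤s = z≤n ; len = 0 ; len≡ = refl ; walk = Walk-refl
      ; injective = λ { {zero} {zero} _ → refl } ; inside = λ _ → inj₁ refl }
    detour zero    da db | no a≢b = contradiction (trans (Distance-zero da) (≡.sym (Distance-zero db))) a≢b
    detour (suc s) da db | no a≢b with Distance-parent da | Distance-parent db
    ... | a' , da' , a'a | b' , db' , b'b =
      detour-extend a≢b da db da' db' (Adj-sym a'a) b'b (detour s da' db')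

    Detour⇒HasCycle : ∀ {s u a b} → Distance G v u s → Adj G u a → Adj G u b → a ≢ b →
                      (δ : Detour s a b) → HasCycle G (2 * Detour.half δ + 2)
    Detour⇒HasCycle {s} {u} {a} {b} du ua ub a≢b δ =
      subst (λ ℓ → HasCycle G (ℓ + 2)) len≡ (close len walk injective inside)
      where
      open Detour δ
      close : ∀ ℓ (w : Walk G ℓ a b) → Injective _≡_ _≡_ (vertices w) →
              (∀ i → EndOrBelow s a b (vertices w i)) → HasCycle G (ℓ + 2)
      close zero    (_ , w0≡a , w0≡b , _) _ _ = contradiction (trans (≡.sym w0≡a) w0≡b) a≢b
      close (suc ℓ) w inj inside-w = Walk⇒HasCycle w inj u∉w ua (Adj-sym ub)
        where
        u∉w : ∀ i → u ≢ vertices w i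
        u∉w i with inside-w i
        ... | inj₁ eq           = λ u≡ → Adj⇒≢ ua (trans u≡ eq)
        ... | inj₂ (inj₁ eq)    = λ u≡ → Adj⇒≢ ub (trans u≡ eq)
        ... | inj₂ (inj₂ below) = Below⇒≢ du below

    module _ {t : ℕ} (no-short : ∀ ℓ → ℓ < 2 * t + 1 → ¬ HasCycle G ℓ)
             (no-2t+2 : ¬ HasCycle G (2 * t + 2)) where

      no-even-cycle : ∀ {h} → h ≤ t → ¬ HasCycle G (2 * h + 2)
      no-even-cycle {h} h≤t with m≤n⇒m<n∨m≡n h≤t
      ... | inj₂ refl = no-2t+2
      ... | inj₁ h<t  = no-short (2 * h + 2) (begin-strict
        2 * h + 2   ≡⟨ trans (+-comm (2 * h) 2) (≡.sym (*-suc 2 h)) ⟩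
        2 * suc h   ≤⟨ *-monoʳ-≤ 2 h<t ⟩
        2 * t       <⟨ m<m+n (2 * t) (s≤s z≤n) ⟩
        2 * t + 1   ∎)
        where open ≤-Reasoning

      sphere-neighbour-unique : ∀ {u w₁ w₂} →
                                Distance G v u t → Distance G v w₁ t → Distance G v w₂ t →
                                Adj G u w₁ → Adj G u w₂ → w₁ ≡ w₂
      sphere-neighbour-unique {w₁ = w₁} {w₂} du dw₁ dw₂ uw₁ uw₂ with w₁ F.≟ w₂
      ... | yes w₁≡w₂ = w₁≡w₂
      ... | no  w₁≢w₂ =
        contradiction (Detour⇒HasCycle du uw₁ uw₂ w₁≢w₂ δ) (no-even-cycle (Detour.half≤s δ))
        where δ = detour t dw₁ dw₂

  module _ {k : ℕ} (regular : Regular G k) (v : Fin n) where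

    children-atMost : ∀ {u d} → Distance G v u (suc d) →
                      AtMost (λ x → Adj G u x × Distance G v x (suc (suc d))) (k ∸ 1)
    children-atMost {u} {d} du {M} uM childM with Distance-parent du
    ... | w , dw , wu = ∸-monoˡ-≤ 1 (subst (suc (length M) ≤_) (regular u)
          (neighbours-atMost (w∉M ∷ uM) (Adj-sym wu ∷ All.map proj₁ childM)))
      where
      w∉M : All (w ≢_) M
      w∉M = All.map (λ (_ , dx) → Distance-≢ dw dx (<⇒≢ (m<n⇒m<1+n (n<1+n d)))) childM

    sphere-atMost : ∀ d → AtMost (λ x → Distance G v x (suc d)) (k * (k ∸ 1) ^ d)
    sphere-atMost zero {L} uL dL = subst (length L ≤_) (trans (regular v) (≡.sym (*-identityʳ k)))
                                        (neighbours-atMost uL (All.map Distance-one dL))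
    sphere-atMost (suc d) = subst (AtMost _) (trans (*-assoc k _ _) (cong (k *_) (*-comm _ (k ∸ 1))))
                                  (AtMost-by-parents F._≟_ Distance-parent Adj? (sphere-atMost d) children-atMost)

lemma1 : (n k t : ℕ) (G : Graph n) → 1 ≤ t → Regular G k
    → HasGirth G (2 * t + 1) → ¬ HasCycle G (2 * t + 2)
    → (v : Fin n) (E : List (Fin n × Fin n))
    → Unique E → All (Horizontal G v t) E
    → 2 * length E ≤ k * (k ∸ 1) ^ (t ∸ 1)
lemma1 _ _ zero    _ () _ _ _ _ _ _ _
lemma1 n k (suc d) G _ regular (_ , no-short) no-2t+2 v E uE horizontal = begin
  2 * length E         ≡⟨ length-endpoints E ⟨
  length (endpoints E) ≤⟨ sphere-atMost G regular v d distinct-endpoints leaf-endpoints ⟩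
  k * (k ∸ 1) ^ d      ∎
  where
  open ≤-Reasoning
  LeafEdge : Rel (Fin n) 0ℓ
  LeafEdge x y = Adj G x y × Leaf G v (suc d) x × Leaf G v (suc d) y
  LeafEdge-sym : Symmetric LeafEdge
  LeafEdge-sym (xy , leaf-x , leaf-y) = Adj-sym G xy , leaf-y , leaf-x
  LeafEdge-functional : ∀ {x y z} → LeafEdge x y → LeafEdge x z → y ≡ z
  LeafEdge-functional (xy , leaf-x , leaf-y) (xz , _ , leaf-z) =
    sphere-neighbour-unique G v no-short no-2t+2 leaf-x leaf-y leaf-z xy xz
  distinct-endpoints : Unique (endpoints E)
  distinct-endpoints =
    endpoints-unique {R = LeafEdge} F.<-asym LeafEdge-sym LeafEdge-functional uE horizontal
  leaf-endpoints : All (Leaf G v (suc d)) (endpoints E)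
  leaf-endpoints = All-endpoints (All.map (λ (_ , _ , leaf-a , leaf-b) → leaf-a , leaf-b) horizontal)
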